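{- Let $p\ge3$ and $n\ge1$ be integers and $r=\min\{n,p\}$. Then \[ \delta(H_p^n)=f_{p,n}(1)=p-1,\qquad \Delta(H_p^n)=f_{p,n}(r)=\binom p2-\binom{p-r}2. \]
   Context: For integers $p\ge 3$, $n\ge 0$, let $[p]_0=\{0,\dots,p-1\}$. The generalized Hanoi graph $H_p^n$ has vertex set $[p]_0^n$: a vertex $s=s_n\cdots s_1$ encodes a state of the Tower of Hanoi with $p$ pegs and $n$ discs of sizes $1<\dots<n$, disc $d$ lying on peg $s_d$. Two vertices are adjacent iff they have the form $\underline{s}\,i\,\overline{s}$ and $\underline{s}\,j\,\overline{s}$ with $i\ne j$, $\underline{s}\in[p]_0^{n-d}$, $\overline{s}\in([p]_0\setminus\{i,j\})^{d-1}$ for some $d$. $f_{p,n}(\mu)=\binom p2-\binom{p-\mu}2=\sum_{\ell=1}^{\mu}(p-\ell)$. $\delta$ and $\Delta$ denote minimum and maximum vertex degree. -}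

module Defs where

open import Data.Nat using (ℕ; zero; suc; _∸_; _≤_)
open import Data.Nat.Combinatorics using (_C_)
open import Data.Fin using (Fin; _<_; _<?_)
open import Data.Fin.Properties using (_≟_; any?; all?)
open import Data.Vec using (Vec; []; _∷_; lookup)
open import Data.List using (List; [_]; map; concatMap; filter; length)
open import Data.List.Base using () renaming (allFin to allFinL)
open import Data.Product using (Σ; ∃; _×_; _,_)
open import Relation.Nullary using (¬_; Dec)
open import Relation.Nullary.Decidable using (_×-dec_; _→-dec_; ¬?)
open import Relation.Binary.PropositionalEquality using (_≡_; _≢_)

-- A vertex of H_p^n (a regular state): position d (0-based) of the vector
-- is the peg of disc d+1.  So larger discs have larger indices.
Vertex : ℕ → ℕ → Set
Vertex p n = Vec (Fin p) n

Adj : ∀ {p n} → Vertex p n → Vertex p n → Set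
Adj {p} {n} s t =
  Σ (Fin n) λ d →
    (lookup s d ≢ lookup t d)
    × (∀ e → d < e → lookup s e ≡ lookup t e)
    × (∀ e → e < d → (lookup s e ≡ lookup t e)
                     × (lookup s e ≢ lookup s d)
                     × (lookup s e ≢ lookup t d))

Adj? : ∀ {p n} (s t : Vertex p n) → Dec (Adj s t)
Adj? s t = any? λ d →
  ¬? (lookup s d ≟ lookup t d)
  ×-dec all? (λ e → (d <? e) →-dec (lookup s e ≟ lookup t e))
  ×-dec all? (λ e → (e <? d) →-dec
      ((lookup s e ≟ lookup t e)
       ×-dec ¬? (lookup s e ≟ lookup s d)
       ×-dec ¬? (lookup s e ≟ lookup t d)))

allVertices : ∀ p n → List (Vertex p n)
allVertices p zero = [ [] ]
allVertices p (suc n) =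
  concatMap (λ i → map (i ∷_) (allVertices p n)) (allFinL p)

degree : ∀ {p n} → Vertex p n → ℕ
degree {p} {n} s = length (filter (Adj? s) (allVertices p n))

MinDegreeIs : ℕ → ℕ → ℕ → Set
MinDegreeIs p n m = (∀ (s : Vertex p n) → m ≤ degree s)
                  × (Σ (Vertex p n) λ s → degree s ≡ m)

MaxDegreeIs : ℕ → ℕ → ℕ → Set
MaxDegreeIs p n m = (∀ (s : Vertex p n) → degree s ≤ m)
                  × (Σ (Vertex p n) λ s → degree s ≡ m)

f : ℕ → ℕ → ℕ → ℕ
f p n μ = p C 2 ∸ (p ∸ μ) C 2

module Submission where

-- A move is a move of one disc, which must be on top of its peg and can go to any
-- other peg carrying no smaller disc.  Reading a state from the smallest disc while
-- recording the set B of pegs already occupied, a disc lying outside B contributes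
-- (number of pegs outside B) − 1 moves and enlarges B by one peg; a disc inside B
-- contributes nothing.  With c pegs outside B and n discs left the total is therefore
-- at most (c−1) + (c−2) + … (n terms, truncated at 0) = C(c,2) − C(c−n,2), attained
-- by putting the smallest discs on distinct pegs.  The smallest disc alone always
-- contributes p − 1, and nothing more is possible when all discs share one peg.

open import Defs
open import Data.Bool using (Bool; true; false; _∨_)
import Data.Bool.Properties as Bool
open import Data.Empty using (⊥)
open import Data.Fin using (Fin; zero; suc; _<?_) renaming (_<_ to _<ᶠ_)
open import Data.Fin.Properties using (_≟_; any?; all?; suc-injective)
open import Data.List using (List; []; _∷_; map; concatMap; filter; length; _++_; allFin)
open import Data.List.Properties using (map-tabulate; length-tabulate)
open import Data.Nat using (ℕ; zero; suc; _+_; _*_; _≤_; _∸_; _⊓_; _⊔_; z≤n; s≤s)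
open import Data.Nat.Properties
  using (+-assoc; +-comm; +-suc; +-identityʳ; *-identityˡ; +-monoʳ-≤; m≤m+n;
         m+n∸n≡m; n∸n≡0; ⊔-identityʳ; ∸-distribˡ-⊓-⊔; module ≤-Reasoning)
  renaming (suc-injective to ℕ-suc-injective)
open import Data.Nat.Combinatorics using (_C_; nC1≡n; nCk+nC[k+1]≡[n+1]C[k+1])
open import Data.Nat.ListAction using (sum)
open import Data.Nat.Solver using (module +-*-Solver)
open import Data.Product using (Σ; _×_; _,_; proj₁; proj₂)
open import Data.Vec using ([]; _∷_; lookup; replicate)
open import Data.Vec.Properties using (∷-injectiveˡ; ∷-injectiveʳ; ≡-dec; tabulate∘lookup; tabulate-cong)
open import Function using (_∘′_)
open import Relation.Nullary using (¬_; Dec; yes; no; does; _because_; contradiction)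
open import Relation.Nullary.Decidable using (_×-dec_; _→-dec_; ¬?)
open import Relation.Unary using (Pred; Decidable; _≐_)
open import Relation.Binary.PropositionalEquality

𝟙 : ∀ {a} {P : Set a} → Dec P → ℕ
𝟙 (true because _) = 1
𝟙 (false because _) = 0

module _ {a b} {P : Set a} {Q : Set b} where

  𝟙-cong : (P → Q) → (Q → P) → (P? : Dec P) (Q? : Dec Q) → 𝟙 P? ≡ 𝟙 Q?
  𝟙-cong _ _ (yes _) (yes _) = refl
  𝟙-cong P→Q Q→P (yes p) (no ¬q) = contradiction (P→Q p) ¬q
  𝟙-cong P→Q Q→P (no ¬p) (yes q) = contradiction (Q→P q) ¬p
  𝟙-cong _ _ (no _) (no _) = refl

module _ {a} {P : Set a} where

  𝟙-yes : P → (P? : Dec P) → 𝟙 P? ≡ 1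
  𝟙-yes _ (yes _) = refl
  𝟙-yes p (no ¬p) = contradiction p ¬p

  𝟙-no : ¬ P → (P? : Dec P) → 𝟙 P? ≡ 0
  𝟙-no ¬p (yes p) = contradiction p ¬p
  𝟙-no _ (no _) = refl

module _ {a} {A : Set a} where

  count : ∀ {ℓ} {P : Pred A ℓ} → Decidable P → List A → ℕ
  count P? [] = 0
  count P? (x ∷ xs) = 𝟙 (P? x) + count P? xs

  module _ {ℓ} {P : Pred A ℓ} (P? : Decidable P) where

    length-filter≡count : ∀ xs → length (filter P? xs) ≡ count P? xs
    length-filter≡count [] = refl
    length-filter≡count (x ∷ xs) with P? x
    ... | yes _ = cong suc (length-filter≡count xs)
    ... | no _ = length-filter≡count xs

    count-none : (∀ x → ¬ P x) → ∀ xs → count P? xs ≡ 0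
    count-none ¬P [] = refl
    count-none ¬P (x ∷ xs) = cong₂ _+_ (𝟙-no (¬P x) (P? x)) (count-none ¬P xs)

    count-all : (∀ x → P x) → ∀ xs → count P? xs ≡ length xs
    count-all allP [] = refl
    count-all allP (x ∷ xs) = cong₂ _+_ (𝟙-yes (allP x) (P? x)) (count-all allP xs)

    count-++ : ∀ xs ys → count P? (xs ++ ys) ≡ count P? xs + count P? ys
    count-++ [] ys = refl
    count-++ (x ∷ xs) ys =
      trans (cong (𝟙 (P? x) +_) (count-++ xs ys)) (sym (+-assoc (𝟙 (P? x)) _ _))

  module _ {ℓ ℓ′} {P : Pred A ℓ} {Q : Pred A ℓ′} (P? : Decidable P) (Q? : Decidable Q) where

    count-cong : P ≐ Q → ∀ xs → count P? xs ≡ count Q? xs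
    count-cong _ [] = refl
    count-cong (P⊆Q , Q⊆P) (x ∷ xs) =
      cong₂ _+_ (𝟙-cong P⊆Q Q⊆P (P? x) (Q? x)) (count-cong (P⊆Q , Q⊆P) xs)

    count-split : ∀ xs → count P? xs ≡
                  count (λ x → P? x ×-dec Q? x) xs + count (λ x → P? x ×-dec ¬? (Q? x)) xs
    count-split [] = refl
    count-split (x ∷ xs) with P? x | Q? x
    ... | yes _ | yes _ = cong suc (count-split xs)
    ... | yes _ | no _ = trans (cong suc (count-split xs)) (sym (+-suc _ _))
    ... | no _ | yes _ = count-split xs
    ... | no _ | no _ = count-split xs

module _ {a b ℓ} {A : Set a} {B : Set b} {P : Pred A ℓ} (P? : Decidable P) where

  count-map : (g : B → A) → ∀ ys → count P? (map g ys) ≡ count (λ y → P? (g y)) ys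
  count-map g [] = refl
  count-map g (y ∷ ys) = cong (𝟙 (P? (g y)) +_) (count-map g ys)

  count-concatMap-map : ∀ {c} {C : Set c} (g : C → B → A) (xs : List B) (zs : List C) →
    count P? (concatMap (λ z → map (g z) xs) zs) ≡ sum (map (λ z → count (λ x → P? (g z x)) xs) zs)
  count-concatMap-map g xs [] = refl
  count-concatMap-map g xs (z ∷ zs) =
    trans (count-++ P? (map (g z) xs) _)
          (cong₂ _+_ (count-map (g z) xs) (count-concatMap-map g xs zs))

module _ {b ℓ ℓ′} {B : Set b} {P : Pred B ℓ} {Q : Pred B ℓ′}
         (P? : Decidable P) (Q? : Decidable Q) where
  open +-*-Solver

  sum-indicators : (X : ℕ) (h : B → ℕ) → (∀ j → h j ≡ 𝟙 (P? j) * X + 𝟙 (Q? j)) →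
                   ∀ js → sum (map h js) ≡ count P? js * X + count Q? js
  sum-indicators X h h≡ [] = refl
  sum-indicators X h h≡ (j ∷ js) =
    trans (cong₂ _+_ (h≡ j) (sum-indicators X h h≡ js))
          (regroup (𝟙 (P? j)) (𝟙 (Q? j)) (count P? js) (count Q? js) X)
    where
    regroup : ∀ a b c d X → a * X + b + (c * X + d) ≡ (a + c) * X + (b + d)
    regroup = solve 5 (λ a b c d X → a :* X :+ b :+ (c :* X :+ d) := (a :+ c) :* X :+ (b :+ d)) refl

allFin-suc : ∀ m → allFin (suc m) ≡ zero ∷ map suc (allFin m)
allFin-suc m = cong (zero ∷_) (sym (map-tabulate (λ i → i) suc))

count-≡-allFin : ∀ {m} (i : Fin m) → count (_≟ i) (allFin m) ≡ 1
count-≡-allFin {suc m} zero = begin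
  count (_≟ zero) (allFin (suc m))
    ≡⟨ cong (count (_≟ zero)) (allFin-suc m) ⟩
  suc (count (_≟ zero) (map suc (allFin m)))
    ≡⟨ cong suc (count-map (_≟ zero) suc (allFin m)) ⟩
  suc (count (λ j → suc j ≟ zero) (allFin m))
    ≡⟨ cong suc (count-none (λ j → suc j ≟ zero) (λ _ ()) (allFin m)) ⟩
  1 ∎
  where open ≡-Reasoning
count-≡-allFin {suc m} (suc i) = begin
  count (_≟ suc i) (allFin (suc m))
    ≡⟨ cong (count (_≟ suc i)) (allFin-suc m) ⟩
  count (_≟ suc i) (map suc (allFin m))
    ≡⟨ count-map (_≟ suc i) suc (allFin m) ⟩
  count (λ j → suc j ≟ suc i) (allFin m)
    ≡⟨ count-cong _ (_≟ i) (suc-injective , cong suc) (allFin m) ⟩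
  count (_≟ i) (allFin m)
    ≡⟨ count-≡-allFin i ⟩
  1 ∎
  where open ≡-Reasoning

module _ {m ℓ} {Q : Pred (Fin m) ℓ} (Q? : Decidable Q) where

  sum-allFin-pick : (h : Fin m → ℕ) (i : Fin m) → ¬ Q i → (∀ j → j ≢ i → h j ≡ 𝟙 (Q? j)) →
                    sum (map h (allFin m)) ≡ h i + count Q? (allFin m)
  sum-allFin-pick h i ¬Qi h≡ = begin
    sum (map h (allFin m))
      ≡⟨ sum-indicators (_≟ i) Q? (h i) h h-split (allFin m) ⟩
    count (_≟ i) (allFin m) * h i + count Q? (allFin m)
      ≡⟨ cong (λ k → k * h i + count Q? (allFin m)) (count-≡-allFin i) ⟩
    1 * h i + count Q? (allFin m)
      ≡⟨ cong (_+ count Q? (allFin m)) (*-identityˡ (h i)) ⟩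
    h i + count Q? (allFin m) ∎
    where
    open ≡-Reasoning
    h-split : ∀ j → h j ≡ 𝟙 (j ≟ i) * h i + 𝟙 (Q? j)
    h-split j with j ≟ i
    ... | yes refl = sym (trans (cong₂ _+_ (*-identityˡ (h i)) (𝟙-no ¬Qi (Q? i))) (+-identityʳ (h i)))
    ... | no j≢i = h≡ j j≢i

module _ {p : ℕ} where

  _≟ᵛ_ : ∀ {n} (s t : Vertex p n) → Dec (s ≡ t)
  _≟ᵛ_ = ≡-dec _≟_

  count-allVertices-suc : ∀ {n ℓ} {P : Pred (Vertex p (suc n)) ℓ} (P? : Decidable P) →
    count P? (allVertices p (suc n))
      ≡ sum (map (λ j → count (λ t → P? (j ∷ t)) (allVertices p n)) (allFin p))
  count-allVertices-suc {n} P? = count-concatMap-map P? _∷_ (allVertices p n) (allFin p)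

  count-≡-allVertices : ∀ {n} (s : Vertex p n) → count (s ≟ᵛ_) (allVertices p n) ≡ 1
  count-≡-allVertices [] = refl
  count-≡-allVertices {suc n} (i ∷ s) =
    trans (count-allVertices-suc ((i ∷ s) ≟ᵛ_))
      (trans (sum-allFin-pick never h i (λ ()) h≡)
        (cong₂ _+_ h-i (count-none never (λ _ ()) (allFin p))))
    where
    never : Decidable {A = Fin p} (λ _ → ⊥)
    never _ = no (λ ())
    h : Fin p → ℕ
    h j = count (λ t → (i ∷ s) ≟ᵛ (j ∷ t)) (allVertices p n)
    h-i : h i ≡ 1
    h-i = trans (count-cong _ (s ≟ᵛ_) (∷-injectiveʳ , cong (i ∷_)) (allVertices p n))
                (count-≡-allVertices s)
    h≡ : ∀ j → j ≢ i → h j ≡ 0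
    h≡ j j≢i = count-none _ (λ t eq → j≢i (sym (∷-injectiveˡ eq))) (allVertices p n)

  count-×-≡-allVertices : ∀ {n c} {C : Set c} (C? : Dec C) (s : Vertex p n) →
                          count (λ t → C? ×-dec (s ≟ᵛ t)) (allVertices p n) ≡ 𝟙 C?
  count-×-≡-allVertices {n} (yes c) s =
    trans (count-cong _ (s ≟ᵛ_) (proj₂ , (c ,_)) (allVertices p n)) (count-≡-allVertices s)
  count-×-≡-allVertices {n} (no ¬c) s = count-none _ (λ t → ¬c ∘′ proj₁) (allVertices p n)

maxDegree : ℕ → ℕ → ℕ
maxDegree c zero = 0
maxDegree c (suc n) = (c ∸ 1) + maxDegree (c ∸ 1) n

maxDegree-≤-suc : ∀ c n → maxDegree c n ≤ maxDegree c (suc n)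
maxDegree-≤-suc c zero = z≤n
maxDegree-≤-suc c (suc n) = +-monoʳ-≤ (c ∸ 1) (maxDegree-≤-suc (c ∸ 1) n)

maxDegree-0 : ∀ n → maxDegree 0 n ≡ 0
maxDegree-0 zero = refl
maxDegree-0 (suc n) = maxDegree-0 n

maxDegree+C≡C : ∀ c n → maxDegree c n + (c ∸ n) C 2 ≡ c C 2
maxDegree+C≡C c zero = refl
maxDegree+C≡C zero (suc n) = trans (+-identityʳ _) (maxDegree-0 (suc n))
maxDegree+C≡C (suc c) (suc n) = begin
  (c + maxDegree c n) + (c ∸ n) C 2  ≡⟨ +-assoc c _ _ ⟩
  c + (maxDegree c n + (c ∸ n) C 2)  ≡⟨ cong (c +_) (maxDegree+C≡C c n) ⟩
  c + c C 2                          ≡⟨ cong (_+ c C 2) (nC1≡n c) ⟨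
  c C 1 + c C 2                      ≡⟨ nCk+nC[k+1]≡[n+1]C[k+1] c 1 ⟩
  suc c C 2                          ∎
  where open ≡-Reasoning

C∸C≡maxDegree : ∀ c n → c C 2 ∸ (c ∸ n) C 2 ≡ maxDegree c n
C∸C≡maxDegree c n = begin
  c C 2 ∸ (c ∸ n) C 2                        ≡⟨ cong (_∸ (c ∸ n) C 2) (maxDegree+C≡C c n) ⟨
  maxDegree c n + (c ∸ n) C 2 ∸ (c ∸ n) C 2  ≡⟨ m+n∸n≡m (maxDegree c n) ((c ∸ n) C 2) ⟩
  maxDegree c n                              ∎
  where open ≡-Reasoning

∸-⊓-self : ∀ c n → c ∸ (n ⊓ c) ≡ c ∸ n
∸-⊓-self c n = begin
  c ∸ (n ⊓ c)            ≡⟨ ∸-distribˡ-⊓-⊔ c n c ⟩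
  (c ∸ n) ⊔ (c ∸ c)      ≡⟨ cong ((c ∸ n) ⊔_) (n∸n≡0 c) ⟩
  (c ∸ n) ⊔ 0            ≡⟨ ⊔-identityʳ (c ∸ n) ⟩
  c ∸ n                  ∎
  where open ≡-Reasoning

module _ {p : ℕ} where

  ∅ : Fin p → Bool
  ∅ _ = false

  _∪⁅_⁆ : (Fin p → Bool) → Fin p → Fin p → Bool
  (B ∪⁅ i ⁆) j = B j ∨ does (j ≟ i)

  Free : (Fin p → Bool) → Fin p → Set
  Free B j = B j ≡ false

  free? : (B : Fin p → Bool) → Decidable (Free B)
  free? B j = B j Bool.≟ false

  free-∪⁺ : ∀ {B i j} → Free B j → j ≢ i → Free (B ∪⁅ i ⁆) j
  free-∪⁺ {B} {i} {j} free-j j≢i with j ≟ i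
  ... | yes j≡i = contradiction j≡i j≢i
  ... | no _ = trans (Bool.∨-identityʳ (B j)) free-j

  free-∪⁻ : ∀ {B i j} → Free (B ∪⁅ i ⁆) j → Free B j × j ≢ i
  free-∪⁻ {B} {i} {j} free-j with B j | j ≟ i
  free-∪⁻ () | true | _
  free-∪⁻ () | false | yes _
  ... | false | no j≢i = refl , j≢i

  ¬free-∪⁅⁆-self : ∀ B k → ¬ Free (B ∪⁅ k ⁆) k
  ¬free-∪⁅⁆-self B k free-k = proj₂ (free-∪⁻ {B} {k} free-k) refl

  ¬free-∪⁅⁆ : ∀ {B i k} → ¬ Free B k → ¬ Free (B ∪⁅ i ⁆) k
  ¬free-∪⁅⁆ {B} {i} ¬free-k = ¬free-k ∘′ proj₁ ∘′ free-∪⁻ {B} {i}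

  -- Adjacency of the states s, t of the larger discs when the smaller discs
  -- occupy the pegs in B: the moved disc must leave and enter a peg outside B.
  AdjBelow : ∀ {n} → (Fin p → Bool) → Vertex p n → Vertex p n → Set
  AdjBelow {n} B s t = Σ (Fin n) λ d →
    (lookup s d ≢ lookup t d)
    × (∀ e → d <ᶠ e → lookup s e ≡ lookup t e)
    × (∀ e → e <ᶠ d → (lookup s e ≡ lookup t e)
                     × (lookup s e ≢ lookup s d)
                     × (lookup s e ≢ lookup t d))
    × Free B (lookup s d) × Free B (lookup t d)

  AdjBelow? : ∀ {n} B (s t : Vertex p n) → Dec (AdjBelow B s t)
  AdjBelow? B s t = any? λ d →
    ¬? (lookup s d ≟ lookup t d)
    ×-dec all? (λ e → (d <? e) →-dec (lookup s e ≟ lookup t e))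
    ×-dec all? (λ e → (e <? d) →-dec
        ((lookup s e ≟ lookup t e)
         ×-dec ¬? (lookup s e ≟ lookup s d)
         ×-dec ¬? (lookup s e ≟ lookup t d)))
    ×-dec free? B (lookup s d) ×-dec free? B (lookup t d)

  Adj⇔AdjBelow∅ : ∀ {n} (s : Vertex p n) → Adj s ≐ AdjBelow ∅ s
  Adj⇔AdjBelow∅ s = (λ (d , moved , above , below) → d , moved , above , below , refl , refl)
                  , (λ (d , moved , above , below , _) → d , moved , above , below)

  AdjBelow-stay⇔ : ∀ {n} B i (s : Vertex p n) →
                   (λ t → AdjBelow B (i ∷ s) (i ∷ t)) ≐ AdjBelow (B ∪⁅ i ⁆) s
  AdjBelow-stay⇔ B i s = stay⇒ , stay⇐
    where
    stay⇒ : ∀ {t} → AdjBelow B (i ∷ s) (i ∷ t) → AdjBelow (B ∪⁅ i ⁆) s t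
    stay⇒ (zero , i≢i , _) = contradiction refl i≢i
    stay⇒ {t} (suc d , moved , above , below , free-s , free-t) =
      d , moved , (λ e d<e → above (suc e) (s≤s d<e)) , (λ e e<d → below (suc e) (s≤s e<d))
      , free-∪⁺ {B} free-s (i≢s ∘′ sym) , free-∪⁺ {B} free-t (i≢t ∘′ sym)
      where
      i≢s : i ≢ lookup s d
      i≢s = proj₁ (proj₂ (below zero (s≤s z≤n)))
      i≢t : i ≢ lookup t d
      i≢t = proj₂ (proj₂ (below zero (s≤s z≤n)))
    stay⇐ : ∀ {t} → AdjBelow (B ∪⁅ i ⁆) s t → AdjBelow B (i ∷ s) (i ∷ t)
    stay⇐ (d , moved , above , below , free-s , free-t) =
      suc d , moved
      , (λ { zero () ; (suc e) (s≤s d<e) → above e d<e })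
      , (λ { zero _ → refl , (λ eq → proj₂ (free-∪⁻ {B} free-s) (sym eq))
                           , (λ eq → proj₂ (free-∪⁻ {B} free-t) (sym eq))
           ; (suc e) (s≤s e<d) → below e e<d })
      , proj₁ (free-∪⁻ {B} free-s) , proj₁ (free-∪⁻ {B} free-t)

  AdjBelow-move⇔ : ∀ {n} B {i j} → j ≢ i → (s : Vertex p n) →
                   (λ t → AdjBelow B (i ∷ s) (j ∷ t)) ≐ (λ t → (Free B i × Free B j) × s ≡ t)
  AdjBelow-move⇔ B {i} {j} j≢i s = move⇒ , move⇐
    where
    move⇒ : ∀ {t} → AdjBelow B (i ∷ s) (j ∷ t) → (Free B i × Free B j) × s ≡ t
    move⇒ {t} (zero , _ , above , _ , free-i , free-j) =
      (free-i , free-j)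
      , trans (sym (tabulate∘lookup s))
          (trans (tabulate-cong (λ e → above (suc e) (s≤s z≤n))) (tabulate∘lookup t))
    move⇒ (suc d , _ , _ , below , _) = contradiction (sym (proj₁ (below zero (s≤s z≤n)))) j≢i
    move⇐ : ∀ {t} → (Free B i × Free B j) × s ≡ t → AdjBelow B (i ∷ s) (j ∷ t)
    move⇐ ((free-i , free-j) , refl) =
      zero , (λ i≡j → j≢i (sym i≡j)) , (λ { zero () ; (suc e) _ → refl }) , (λ _ ()) , free-i , free-j

  degreeBelow : ∀ {n} → (Fin p → Bool) → Vertex p n → ℕ
  degreeBelow {n} B s = count (AdjBelow? B s) (allVertices p n)

  degree≡degreeBelow∅ : ∀ {n} (s : Vertex p n) → degree s ≡ degreeBelow ∅ s
  degree≡degreeBelow∅ {n} s =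
    trans (length-filter≡count (Adj? s) (allVertices p n))
          (count-cong (Adj? s) (AdjBelow? ∅ s) (Adj⇔AdjBelow∅ s) (allVertices p n))

  movable? : (B : Fin p → Bool) (i j : Fin p) → Dec ((Free B i × Free B j) × j ≢ i)
  movable? B i j = (free? B i ×-dec free? B j) ×-dec ¬? (j ≟ i)

  discMoves : (Fin p → Bool) → Fin p → ℕ
  discMoves B i = count (movable? B i) (allFin p)

  degreeBelow-∷ : ∀ {n} B i (s : Vertex p n) →
                  degreeBelow B (i ∷ s) ≡ discMoves B i + degreeBelow (B ∪⁅ i ⁆) s
  degreeBelow-∷ {n} B i s = begin
    degreeBelow B (i ∷ s)
      ≡⟨ count-allVertices-suc (AdjBelow? B (i ∷ s)) ⟩
    sum (map moves (allFin p))
      ≡⟨ sum-allFin-pick (movable? B i) moves i (λ (_ , i≢i) → i≢i refl) moves≡ ⟩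
    moves i + discMoves B i
      ≡⟨ cong (_+ discMoves B i) stay ⟩
    degreeBelow (B ∪⁅ i ⁆) s + discMoves B i
      ≡⟨ +-comm _ (discMoves B i) ⟩
    discMoves B i + degreeBelow (B ∪⁅ i ⁆) s ∎
    where
    open ≡-Reasoning
    moves : Fin p → ℕ
    moves j = count (λ t → AdjBelow? B (i ∷ s) (j ∷ t)) (allVertices p n)
    stay : moves i ≡ degreeBelow (B ∪⁅ i ⁆) s
    stay = count-cong _ (AdjBelow? (B ∪⁅ i ⁆) s) (AdjBelow-stay⇔ B i s) (allVertices p n)
    moves≡ : ∀ j → j ≢ i → moves j ≡ 𝟙 (movable? B i j)
    moves≡ j j≢i = begin
      moves j
        ≡⟨ count-cong _ _ (AdjBelow-move⇔ B j≢i s) (allVertices p n) ⟩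
      count (λ t → (free? B i ×-dec free? B j) ×-dec (s ≟ᵛ t)) (allVertices p n)
        ≡⟨ count-×-≡-allVertices _ s ⟩
      𝟙 (free? B i ×-dec free? B j)
        ≡⟨ 𝟙-cong (_, j≢i) proj₁ (free? B i ×-dec free? B j) (movable? B i j) ⟩
      𝟙 (movable? B i j) ∎

  freeCount : (Fin p → Bool) → ℕ
  freeCount B = count (free? B) (allFin p)

  freeCount-∅ : freeCount ∅ ≡ p
  freeCount-∅ = trans (count-all (free? ∅) (λ _ → refl) (allFin p)) (length-tabulate (λ i → i))

  module _ (B : Fin p → Bool) (i : Fin p) where

    discMoves-blocked : ¬ Free B i → discMoves B i ≡ 0
    discMoves-blocked ¬free-i =
      count-none (movable? B i) (λ _ ((free-i , _) , _) → ¬free-i free-i) (allFin p)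

    freeCount-∪⁅⁆-blocked : ¬ Free B i → freeCount (B ∪⁅ i ⁆) ≡ freeCount B
    freeCount-∪⁅⁆-blocked ¬free-i =
      count-cong _ _ ( proj₁ ∘′ free-∪⁻ {B}
                     , λ free-j → free-∪⁺ {B} free-j (λ { refl → ¬free-i free-j }))
                 (allFin p)

    discMoves-free : Free B i → discMoves B i ≡ freeCount (B ∪⁅ i ⁆)
    discMoves-free free-i =
      count-cong _ _ ( (λ ((_ , free-j) , j≢i) → free-∪⁺ {B} free-j j≢i)
                     , λ free-j → let (free-j , j≢i) = free-∪⁻ {B} free-j in (free-i , free-j) , j≢i)
                 (allFin p)

    freeCount-∪⁅⁆-free : Free B i → freeCount B ≡ suc (freeCount (B ∪⁅ i ⁆))
    freeCount-∪⁅⁆-free free-i = begin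
      freeCount B
        ≡⟨ count-split (free? B) (_≟ i) (allFin p) ⟩
      count (λ j → free? B j ×-dec (j ≟ i)) (allFin p) + count (λ j → free? B j ×-dec ¬? (j ≟ i)) (allFin p)
        ≡⟨ cong₂ _+_ just-i others ⟩
      1 + freeCount (B ∪⁅ i ⁆) ∎
      where
      open ≡-Reasoning
      just-i : count (λ j → free? B j ×-dec (j ≟ i)) (allFin p) ≡ 1
      just-i = trans (count-cong _ (_≟ i) (proj₂ , λ { refl → free-i , refl }) (allFin p))
                     (count-≡-allFin i)
      others : count (λ j → free? B j ×-dec ¬? (j ≟ i)) (allFin p) ≡ freeCount (B ∪⁅ i ⁆)
      others = count-cong _ _ ((λ (free-j , j≢i) → free-∪⁺ {B} free-j j≢i) , free-∪⁻ {B}) (allFin p)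

  suc-discMoves-∅ : ∀ i → suc (discMoves ∅ i) ≡ p
  suc-discMoves-∅ i = begin
    suc (discMoves ∅ i)        ≡⟨ cong suc (discMoves-free ∅ i refl) ⟩
    suc (freeCount (∅ ∪⁅ i ⁆)) ≡⟨ freeCount-∪⁅⁆-free ∅ i refl ⟨
    freeCount ∅                ≡⟨ freeCount-∅ ⟩
    p                          ∎
    where open ≡-Reasoning

  degreeBelow≤maxDegree : ∀ {n} B (s : Vertex p n) → degreeBelow B s ≤ maxDegree (freeCount B) n
  degreeBelow≤maxDegree B [] = z≤n
  degreeBelow≤maxDegree {suc n} B (i ∷ s) = bound (free? B i)
    where
    open ≤-Reasoning
    bound : Dec (Free B i) → degreeBelow B (i ∷ s) ≤ maxDegree (freeCount B) (suc n)
    bound (yes free-i) = begin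
      degreeBelow B (i ∷ s)
        ≡⟨ degreeBelow-∷ B i s ⟩
      discMoves B i + degreeBelow (B ∪⁅ i ⁆) s
        ≡⟨ cong (_+ degreeBelow (B ∪⁅ i ⁆) s) (discMoves-free B i free-i) ⟩
      c + degreeBelow (B ∪⁅ i ⁆) s
        ≤⟨ +-monoʳ-≤ c (degreeBelow≤maxDegree (B ∪⁅ i ⁆) s) ⟩
      c + maxDegree c n
        ≡⟨ cong (λ c′ → maxDegree c′ (suc n)) (freeCount-∪⁅⁆-free B i free-i) ⟨
      maxDegree (freeCount B) (suc n) ∎
      where
      c : ℕ
      c = freeCount (B ∪⁅ i ⁆)
    bound (no ¬free-i) = begin
      degreeBelow B (i ∷ s)
        ≡⟨ degreeBelow-∷ B i s ⟩
      discMoves B i + degreeBelow (B ∪⁅ i ⁆) s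
        ≡⟨ cong (_+ degreeBelow (B ∪⁅ i ⁆) s) (discMoves-blocked B i ¬free-i) ⟩
      degreeBelow (B ∪⁅ i ⁆) s
        ≤⟨ degreeBelow≤maxDegree (B ∪⁅ i ⁆) s ⟩
      maxDegree (freeCount (B ∪⁅ i ⁆)) n
        ≡⟨ cong (λ c → maxDegree c n) (freeCount-∪⁅⁆-blocked B i ¬free-i) ⟩
      maxDegree (freeCount B) n
        ≤⟨ maxDegree-≤-suc (freeCount B) n ⟩
      maxDegree (freeCount B) (suc n) ∎

  degreeBelow-replicate-blocked : ∀ n B {k} → ¬ Free B k → degreeBelow B (replicate n k) ≡ 0
  degreeBelow-replicate-blocked zero B ¬free-k = refl
  degreeBelow-replicate-blocked (suc n) B {k} ¬free-k =
    trans (degreeBelow-∷ B k (replicate n k))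
          (cong₂ _+_ (discMoves-blocked B k ¬free-k)
                     (degreeBelow-replicate-blocked n (B ∪⁅ k ⁆) (¬free-∪⁅⁆ {B = B} ¬free-k)))

  -- Each disc, from the smallest, goes to a still free peg as long as there is one.
  maxDegree-attained : ∀ n B → Fin p → Σ (Vertex p n) λ s → degreeBelow B s ≡ maxDegree (freeCount B) n
  maxDegree-attained zero B _ = [] , refl
  maxDegree-attained (suc n) B z with any? (free? B)
  ... | yes (i , free-i) =
    let (s , s-max) = maxDegree-attained n (B ∪⁅ i ⁆) z in
    i ∷ s , (begin
      degreeBelow B (i ∷ s)
        ≡⟨ degreeBelow-∷ B i s ⟩
      discMoves B i + degreeBelow (B ∪⁅ i ⁆) s
        ≡⟨ cong₂ _+_ (discMoves-free B i free-i) s-max ⟩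
      freeCount (B ∪⁅ i ⁆) + maxDegree (freeCount (B ∪⁅ i ⁆)) n
        ≡⟨ cong (λ c → maxDegree c (suc n)) (freeCount-∪⁅⁆-free B i free-i) ⟨
      maxDegree (freeCount B) (suc n) ∎)
    where open ≡-Reasoning
  ... | no none = replicate (suc n) z , (begin
      degreeBelow B (replicate (suc n) z)
        ≡⟨ degreeBelow-replicate-blocked (suc n) B (λ free-z → none (z , free-z)) ⟩
      0
        ≡⟨ maxDegree-0 (suc n) ⟨
      maxDegree 0 (suc n)
        ≡⟨ cong (λ c → maxDegree c (suc n)) no-free ⟨
      maxDegree (freeCount B) (suc n) ∎)
    where
    open ≡-Reasoning
    no-free : freeCount B ≡ 0
    no-free = count-none (free? B) (λ j free-j → none (j , free-j)) (allFin p)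

minDegree-Hanoi : ∀ q m → MinDegreeIs (suc q) (suc m) q
minDegree-Hanoi q m = lower , replicate (suc m) zero , perfect
  where
  smallest-moves : ∀ i → discMoves ∅ i ≡ q
  smallest-moves i = ℕ-suc-injective (suc-discMoves-∅ i)
  degree-∷ : ∀ i (s : Vertex (suc q) m) → degree (i ∷ s) ≡ q + degreeBelow (∅ ∪⁅ i ⁆) s
  degree-∷ i s = trans (degree≡degreeBelow∅ (i ∷ s))
                       (trans (degreeBelow-∷ ∅ i s)
                              (cong (_+ degreeBelow (∅ ∪⁅ i ⁆) s) (smallest-moves i)))
  lower : ∀ (s : Vertex (suc q) (suc m)) → q ≤ degree s
  lower (i ∷ s) = subst (q ≤_) (sym (degree-∷ i s)) (m≤m+n q _)
  perfect : degree (replicate (suc m) zero) ≡ q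
  perfect = trans (degree-∷ zero (replicate m zero))
                  (trans (cong (q +_) (degreeBelow-replicate-blocked m (∅ ∪⁅ zero ⁆) (¬free-∪⁅⁆-self {suc q} ∅ zero)))
                         (+-identityʳ q))

maxDegree-Hanoi : ∀ q n → MaxDegreeIs (suc q) n (maxDegree (suc q) n)
maxDegree-Hanoi q n with maxDegree-attained n ∅ zero
... | s , s-max = upper , s , trans (degree≡degreeBelow∅ s) (trans s-max freeCount≡p)
  where
  freeCount≡p : maxDegree (freeCount (∅ {suc q})) n ≡ maxDegree (suc q) n
  freeCount≡p = cong (λ c → maxDegree c n) freeCount-∅
  upper : ∀ (t : Vertex (suc q) n) → degree t ≤ maxDegree (suc q) n
  upper t = subst₂ _≤_ (sym (degree≡degreeBelow∅ t)) freeCount≡p (degreeBelow≤maxDegree ∅ t)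

mainTheorem12 : ∀ (p n : ℕ) → 3 ≤ p → 1 ≤ n →
    MinDegreeIs p n (f p n 1) × f p n 1 ≡ p ∸ 1
    × MaxDegreeIs p n (f p n (n ⊓ p)) × f p n (n ⊓ p) ≡ p C 2 ∸ (p ∸ (n ⊓ p)) C 2
mainTheorem12 p@(suc q) n@(suc m) _ _ =
    subst (MinDegreeIs p n) (sym f₁≡q) (minDegree-Hanoi q m) , f₁≡q
  , subst (MaxDegreeIs p n) (sym fᵣ≡maxDegree) (maxDegree-Hanoi q n) , refl
  where
  f₁≡q : f p n 1 ≡ q
  f₁≡q = trans (C∸C≡maxDegree p 1) (+-identityʳ q)
  fᵣ≡maxDegree : f p n (n ⊓ p) ≡ maxDegree p n
  fᵣ≡maxDegree = trans (cong (λ k → p C 2 ∸ k C 2) (∸-⊓-self p n)) (C∸C≡maxDegree p n)
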